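{- Let $A$ be a finite set, let $(B;+)$ be a finite Boolean group, let $n \ge 1$ and $t \ge 0$ be integers with $n - |A| = 2t + 1 > 0$, and let $f \colon A^n \to B$. Then $f$ is determined by $\operatorname{oddsupp}$ if and only if there is a map $\varphi \colon \mathcal{P}'_n(A) \to B$ such that for all $\mathbf{x} \in A^n$ \[ f(\mathbf{x}) = \sum_{i = t + 1}^{\lfloor n/2 \rfloor} \sum_{\substack{I \subseteq [n] \\ |I| = n - 2i}} \binom{i - 1}{t} \varphi(\operatorname{oddsupp}(\mathbf{x}|_I)). \] Moreover, such a $\varphi$ is uniquely determined by $f$.
   Context: A Boolean group is an abelian group in which $b + b = 0$ for all $b$; an integer coefficient $m$ times an element $b$ means $b + \dots + b$ ($m$ times), so it equals $b$ if $m$ is odd and $0$ if $m$ is even. $[n] = \{1,\dots,n\}$. For $\mathbf{x} \in A^n$ and $I = \{i_1 < \dots < i_k\} \subseteq [n]$, $\mathbf{x}|_I = (x_{i_1}, \dots, x_{i_k})$ (the empty tuple if $I = \emptyset$). For a tuple $(a_1,\dots,a_m)$ over $A$ ($m \ge 0$), $\operatorname{oddsupp}(a_1,\dots,a_m) = \{a \in A : |\{j : a_j = a\}| \text{ is odd}\}$ (so $\operatorname{oddsupp}$ of the empty tuple is $\emptyset$). $\mathcal{P}'_n(A)$ is the set of subsets $S \subseteq A$ with $|S| \in \{n, n-2, n-4, \dots\}$. A function $f \colon A^n \to B$ is determined by $\operatorname{oddsupp}$ if there is a map $\psi \colon \mathcal{P}(A) \to B$ with $f(\mathbf{x}) = \psi(\operatorname{oddsupp}(\mathbf{x}))$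 for all $\mathbf{x} \in A^n$. -}

module Defs where

open import Level using (Level)
open import Data.Bool using (Bool; true; false; if_then_else_)
open import Data.Nat using (ℕ; zero; suc; _+_; _*_; _∸_; _≤_; _/_)
open import Data.Nat.Combinatorics using (_C_)
open import Data.Nat.Divisibility using (_∣_)
open import Data.Fin using (Fin; zero; suc)
open import Data.Fin.Properties using (_≟_)
open import Data.Fin.Subset using (Subset; ∣_∣; inside; outside)
open import Data.List using (List; []; _∷_; map; concatMap; filter; length; upTo; foldr)
open import Data.List.Membership.Propositional using (_∈_)
open import Data.Vec using (Vec; []; _∷_; tabulate)
open import Data.Product using (Σ; _×_; _,_)
open import Relation.Nullary.Decidable using (does)
import Data.List.Relation.Unary.Any
import Data.Nat
open import Relation.Binary.PropositionalEquality using (_≡_)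
open import Algebra.Bundles using (AbelianGroup)

isOdd : ℕ → Bool
isOdd zero = false
isOdd (suc k) with isOdd k
... | true = false
... | false = true

count : {m : ℕ} → Fin m → List (Fin m) → ℕ
count a xs = length (filter (λ y → y ≟ a) xs)

oddsupp : {m : ℕ} → List (Fin m) → Subset m
oddsupp xs = tabulate (λ a → isOdd (count a xs))

restrict : {A : Set} {n : ℕ} → Vec A n → Subset n → List A
restrict [] [] = []
restrict (x ∷ xs) (true ∷ I) = x ∷ restrict xs I
restrict (x ∷ xs) (false ∷ I) = restrict xs I

allSubsets : (n : ℕ) → List (Subset n)
allSubsets zero = [] ∷ []
allSubsets (suc n) = concatMap (λ I → (outside ∷ I) ∷ (inside ∷ I) ∷ []) (allSubsets n)

subsetsOfSize : (n k : ℕ) → List (Subset n)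
subsetsOfSize n k = filter (λ I → ∣ I ∣ Data.Nat.≟ k) (allSubsets n)

InP' : {m : ℕ} → ℕ → Subset m → Set
InP' n S = ∣ S ∣ ≤ n × 2 ∣ (n ∸ ∣ S ∣)

module BG {c ℓ : Level} (B : AbelianGroup c ℓ) where
  open AbelianGroup B

  IsBoolean : Set (c Level.⊔ ℓ)
  IsBoolean = ∀ b → b ∙ b ≈ ε

  IsFinite : Set (c Level.⊔ ℓ)
  IsFinite = Σ (List Carrier) λ bs → ∀ b → Data.List.Relation.Unary.Any.Any (λ b' → b ≈ b') bs

  _·_ : ℕ → Carrier → Carrier
  zero · b = ε
  suc k · b = b ∙ (k · b)

  ∑ : List Carrier → Carrier
  ∑ = foldr _∙_ ε

  DeterminedByOddsupp : {m n : ℕ} → (Vec (Fin m) n → Carrier) → Set (c Level.⊔ ℓ)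
  DeterminedByOddsupp {m} {n} f =
    Σ (Subset m → Carrier) λ ψ → ∀ x → f x ≈ ψ (oddsupp (Data.Vec.toList x))

  rhs : {m : ℕ} (n t : ℕ) → (Subset m → Carrier) → Vec (Fin m) n → Carrier
  rhs n t φ x =
    ∑ (map (λ i → ∑ (map (λ I → ((i ∸ 1) C t) · φ (oddsupp (restrict x I)))
                         (subsetsOfSize n (n ∸ 2 * i))))
           (map (λ j → suc t + j) (upTo (n / 2 ∸ t))))

  Represents : {m n : ℕ} (t : ℕ) → (Subset m → Carrier) → (Vec (Fin m) n → Carrier) → Set ℓ
  Represents {n = n} t φ f = ∀ x → f x ≈ rhs n t φ x

-- The right-hand side depends on x only through the weighted subset sum Σ_{I ⊆ [n]} w(|I|, oddsupp(x|_I)),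
-- where w(k, T) = Σ_{i : n − 2i = k} C(i − 1, t) · φ(T). Prepending a letter a to x replaces a weight h by
-- Δ_a h (k, T) = h(k, T) + h(k + 1, T △ {a}). These operators commute, and since b + b = 0 we have
-- Δ_a Δ_a = Δ² with Δ² h (k, T) = h(k, T) + h(k + 2, T). Cancelling repeated letters in pairs, the sum becomes
-- (Δ_{c₁} ⋯ Δ_{c_s} (Δ²)^Q w)(0, ∅), where c₁, …, c_s enumerate oddsupp x and s + 2Q = n. By Pascal's rule
-- mod 2, (Δ²)^(t + 1) turns the binomial coefficients of w into the single spike φ at size |A| − 1; because
-- n − |A| = 2t + 1, the remaining Q − t − 1 factors Δ² move the spike down to size s, where Δ_{c₁} ⋯ Δ_{c_s}
-- reads off φ(oddsupp x). Hence the right-hand side is φ ∘ oddsupp for every φ, which gives both implications;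
-- uniqueness holds because every S ∈ P'_n(A) is oddsupp x for some x (pad S with pairs of one letter).

module Submission where

open import Defs
open import Level using (Level)
open import Algebra.Bundles using (AbelianGroup)
import Algebra.Properties.CommutativeSemigroup as CommutativeSemigroupProperties
open import Data.Bool using (Bool; true; false; not; if_then_else_; _xor_)
open import Data.Bool.Properties using (not-involutive)
open import Data.Fin using (Fin; zero; suc)
open import Data.Fin.Properties using (_≟_)
open import Data.Fin.Subset using (Subset; ∣_∣; inside; outside)
open import Data.Fin.Subset.Properties using (∣p∣≤n)
open import Data.List using (List; []; _∷_; _++_; length; map; filter; concatMap; replicate; upTo; applyUpTo)
open import Data.List.Properties using (length-++; ++-assoc; length-map; length-replicate; map-∘; map-upTo)
open import Data.List.Membership.Propositional using (_∈_)
open import Data.List.Membership.Propositional.Properties using (∈-∃++)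
open import Data.List.Relation.Unary.Any using (here; there)
open import Data.List.Relation.Binary.Permutation.Propositional as Perm
  using (_↭_; prep; ↭-trans; ↭-sym; module PermutationReasoning)
open import Data.List.Relation.Binary.Permutation.Propositional.Properties using (shift; ↭-length)
open import Data.Maybe using (Maybe; just; nothing; maybe′; _>>=_) renaming (map to mapᴹ)
open import Data.Maybe.Properties using (just-injective)
open import Data.Nat using (ℕ; zero; suc; _+_; _*_; _∸_; _≤_; _<_; s≤s; z≤n; _/_)
import Data.Nat as ℕ
open import Data.Nat.Properties
  using ( suc-injective; +-suc; *-suc; +-identityʳ; +-comm; *-comm; *-distribˡ-+; m∸n+n≡m; m+n∸n≡m
        ; m+[n∸m]≡n; [m+n]∸[m+o]≡n∸o; +-cancelʳ-≡; +-cancelˡ-≤; *-cancelˡ-<; +-monoˡ-≤; *-monoˡ-≤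
        ; <-irrefl; n<1+n; m<n⇒m<1+n; ≤-trans; ≤-reflexive; m≤n+m; module ≤-Reasoning)
open import Data.Nat.DivMod using (+-distrib-/-∣ʳ; m*n/n≡m; m/n*n≤m; /-monoˡ-≤)
open import Data.Nat.Divisibility using (_∣_; divides; ∣1⇒≡1; ∣m+n∣m⇒∣n; m∣m*n)
open import Data.Nat.Combinatorics using (_C_; nCn≡1; nCk+nC[k+1]≡[n+1]C[k+1])
open import Data.Nat.Tactic.RingSolver using (solve-∀)
open import Data.Product using (Σ; ∃; _×_; _,_; proj₁; proj₂)
open import Data.Vec using (Vec; []; _∷_; lookup; tabulate; toList; fromList)
open import Data.Vec.Properties using (tabulate-cong; lookup∘tabulate; length-toList; toList∘fromList)
open import Relation.Nullary using (yes; no; ¬_; contradiction)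
open import Relation.Nullary.Decidable using (does; dec-true; dec-false)
open import Relation.Unary using (Decidable)
open import Relation.Binary.PropositionalEquality
  using (_≡_; refl; sym; trans; cong; cong₂; subst; module ≡-Reasoning)

isOdd-suc : ∀ k → isOdd (suc k) ≡ not (isOdd k)
isOdd-suc k with isOdd k
... | true  = refl
... | false = refl

isOdd-+ : ∀ x y → isOdd (x + y) ≡ isOdd x xor isOdd y
isOdd-+ zero    y = refl
isOdd-+ (suc x) y rewrite isOdd-suc (x + y) | isOdd-suc x | isOdd-+ x y with isOdd x
... | true  = not-involutive (isOdd y)
... | false = refl

toggle : ∀ {m} → Fin m → Subset m → Subset m
toggle zero    (b ∷ S) = not b ∷ S
toggle (suc a) (b ∷ S) = b ∷ toggle a S

toggle-involutive : ∀ {m} (a : Fin m) S → toggle a (toggle a S) ≡ S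
toggle-involutive zero    (b ∷ S) = cong (_∷ S) (not-involutive b)
toggle-involutive (suc a) (b ∷ S) = cong (b ∷_) (toggle-involutive a S)

toggle-comm : ∀ {m} (a b : Fin m) S → toggle a (toggle b S) ≡ toggle b (toggle a S)
toggle-comm zero    zero    S       = refl
toggle-comm zero    (suc b) (x ∷ S) = refl
toggle-comm (suc a) zero    (x ∷ S) = refl
toggle-comm (suc a) (suc b) (x ∷ S) = cong (x ∷_) (toggle-comm a b S)

lookup-toggle-≢ : ∀ {m} (a b : Fin m) S → ¬ a ≡ b → lookup (toggle a S) b ≡ lookup S b
lookup-toggle-≢ zero    zero    S       a≢b = contradiction refl a≢b
lookup-toggle-≢ zero    (suc b) (x ∷ S) a≢b = refl
lookup-toggle-≢ (suc a) zero    (x ∷ S) a≢b = refl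
lookup-toggle-≢ (suc a) (suc b) (x ∷ S) a≢b = lookup-toggle-≢ a b S (λ a≡b → a≢b (cong suc a≡b))

∣toggle∣-outside : ∀ {m} (a : Fin m) S → lookup S a ≡ false → ∣ toggle a S ∣ ≡ suc ∣ S ∣
∣toggle∣-outside zero    (false ∷ S) a∉S = refl
∣toggle∣-outside (suc a) (true  ∷ S) a∉S = cong suc (∣toggle∣-outside a S a∉S)
∣toggle∣-outside (suc a) (false ∷ S) a∉S = ∣toggle∣-outside a S a∉S

∣toggle∣-inside : ∀ {m} (a : Fin m) S → lookup S a ≡ true → suc ∣ toggle a S ∣ ≡ ∣ S ∣
∣toggle∣-inside zero    (true  ∷ S) a∈S = refl
∣toggle∣-inside (suc a) (true  ∷ S) a∈S = cong suc (∣toggle∣-inside a S a∈S)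
∣toggle∣-inside (suc a) (false ∷ S) a∈S = ∣toggle∣-inside a S a∈S

toggle-tabulate : ∀ {m} (a : Fin m) (f : Fin m → Bool) →
  toggle a (tabulate f) ≡ tabulate (λ b → if does (a ≟ b) then not (f b) else f b)
toggle-tabulate zero    f = refl
toggle-tabulate (suc a) f = cong (f zero ∷_) (toggle-tabulate a (λ b → f (suc b)))

count-∷ : ∀ {m} (a b : Fin m) l → count b (a ∷ l) ≡ (if does (a ≟ b) then suc (count b l) else count b l)
count-∷ a b l with does (a ≟ b)
... | true  = refl
... | false = refl

oddsupp-∷ : ∀ {m} (a : Fin m) l → oddsupp (a ∷ l) ≡ toggle a (oddsupp l)
oddsupp-∷ a l = trans (tabulate-cong isOdd-count-∷) (sym (toggle-tabulate a (λ b → isOdd (count b l))))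
  where
  isOdd-count-∷ : ∀ b → isOdd (count b (a ∷ l)) ≡ (if does (a ≟ b) then not (isOdd (count b l)) else isOdd (count b l))
  isOdd-count-∷ b rewrite count-∷ a b l with does (a ≟ b)
  ... | true  = isOdd-suc (count b l)
  ... | false = refl

lookup-oddsupp-[] : ∀ {m} (a : Fin m) → lookup (oddsupp {m} []) a ≡ false
lookup-oddsupp-[] a = lookup∘tabulate (λ _ → false) a

∣oddsupp-[]∣ : ∀ {m} → ∣ oddsupp {m} [] ∣ ≡ 0
∣oddsupp-[]∣ {zero}  = refl
∣oddsupp-[]∣ {suc m} = ∣oddsupp-[]∣ {m}

∈-oddsupp⇒∈ : ∀ {m} (a : Fin m) l → lookup (oddsupp l) a ≡ true → a ∈ l
∈-oddsupp⇒∈ a []      a∈ = contradiction (trans (sym (lookup-oddsupp-[] a)) a∈) λ ()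
∈-oddsupp⇒∈ a (b ∷ l) a∈ with b ≟ a
... | yes refl = here refl
... | no  b≢a  = there (∈-oddsupp⇒∈ a l (begin
  lookup (oddsupp l) a              ≡⟨ sym (lookup-toggle-≢ b a (oddsupp l) b≢a) ⟩
  lookup (toggle b (oddsupp l)) a   ≡⟨ cong (λ S → lookup S a) (sym (oddsupp-∷ b l)) ⟩
  lookup (oddsupp (b ∷ l)) a        ≡⟨ a∈ ⟩
  true                              ∎))
  where open ≡-Reasoning

oddsupp-↭ : ∀ {m} {xs ys : List (Fin m)} → xs ↭ ys → oddsupp xs ≡ oddsupp ys
oddsupp-↭ Perm.refl = refl
oddsupp-↭ (Perm.prep a p) = trans (oddsupp-∷ a _) (trans (cong (toggle a) (oddsupp-↭ p)) (sym (oddsupp-∷ a _)))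
oddsupp-↭ (Perm.swap {xs} {ys} a b p) = begin
  oddsupp (a ∷ b ∷ xs)                   ≡⟨ oddsupp-∷ a _ ⟩
  toggle a (oddsupp (b ∷ xs))            ≡⟨ cong (toggle a) (oddsupp-∷ b xs) ⟩
  toggle a (toggle b (oddsupp xs))       ≡⟨ cong (λ S → toggle a (toggle b S)) (oddsupp-↭ p) ⟩
  toggle a (toggle b (oddsupp ys))       ≡⟨ toggle-comm a b _ ⟩
  toggle b (toggle a (oddsupp ys))       ≡⟨ cong (toggle b) (sym (oddsupp-∷ a ys)) ⟩
  toggle b (oddsupp (a ∷ ys))            ≡⟨ sym (oddsupp-∷ b _) ⟩
  oddsupp (b ∷ a ∷ ys)                   ∎
  where open ≡-Reasoning
oddsupp-↭ (Perm.trans p q) = trans (oddsupp-↭ p) (oddsupp-↭ q)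

doubles : ∀ {A : Set} → List A → List A
doubles []       = []
doubles (a ∷ ps) = a ∷ a ∷ doubles ps

length-doubles : ∀ {A : Set} (ps : List A) → length (doubles ps) ≡ 2 * length ps
length-doubles []       = refl
length-doubles (a ∷ ps) = trans (cong (λ l → suc (suc l)) (length-doubles ps)) (sym (*-suc 2 (length ps)))

oddsupp-doubles-++ : ∀ {m} (ps l : List (Fin m)) → oddsupp (doubles ps ++ l) ≡ oddsupp l
oddsupp-doubles-++ []       l = refl
oddsupp-doubles-++ (a ∷ ps) l = begin
  oddsupp (a ∷ a ∷ doubles ps ++ l)                 ≡⟨ oddsupp-∷ a _ ⟩
  toggle a (oddsupp (a ∷ doubles ps ++ l))          ≡⟨ cong (toggle a) (oddsupp-∷ a _) ⟩
  toggle a (toggle a (oddsupp (doubles ps ++ l)))   ≡⟨ toggle-involutive a _ ⟩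
  oddsupp (doubles ps ++ l)                         ≡⟨ oddsupp-doubles-++ ps l ⟩
  oddsupp l                                         ∎
  where open ≡-Reasoning

oddsupp-++-∷ : ∀ {m} (ys : List (Fin m)) a zs → oddsupp (ys ++ a ∷ zs) ≡ toggle a (oddsupp (ys ++ zs))
oddsupp-++-∷ ys a zs = trans (oddsupp-↭ (shift a ys zs)) (oddsupp-∷ a (ys ++ zs))

∣oddsupp∣-remove : ∀ {m} (ys : List (Fin m)) a zs → lookup (oddsupp (ys ++ a ∷ zs)) a ≡ true →
  suc ∣ oddsupp (ys ++ zs) ∣ ≡ ∣ oddsupp (ys ++ a ∷ zs) ∣
∣oddsupp∣-remove ys a zs a∈ = begin
  suc ∣ oddsupp (ys ++ zs) ∣                       ≡⟨ cong (λ S → suc ∣ S ∣) (sym (toggle-involutive a _)) ⟩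
  suc ∣ toggle a (toggle a (oddsupp (ys ++ zs))) ∣ ≡⟨ cong (λ S → suc ∣ toggle a S ∣) (sym (oddsupp-++-∷ ys a zs)) ⟩
  suc ∣ toggle a (oddsupp (ys ++ a ∷ zs)) ∣        ≡⟨ ∣toggle∣-inside a _ a∈ ⟩
  ∣ oddsupp (ys ++ a ∷ zs) ∣                       ∎
  where open ≡-Reasoning

length-++-∷ : ∀ {A : Set} (ys : List A) a zs → length (ys ++ a ∷ zs) ≡ suc (length (ys ++ zs))
length-++-∷ ys a zs = ↭-length (shift a ys zs)

length-↭-doubles++ : ∀ {A : Set} {x} (ps l : List A) → x ↭ doubles ps ++ l → length x ≡ length l + 2 * length ps
length-↭-doubles++ {x = x} ps l x↭ = begin
  length x                       ≡⟨ ↭-length x↭ ⟩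
  length (doubles ps ++ l)       ≡⟨ length-++ (doubles ps) ⟩
  length (doubles ps) + length l ≡⟨ +-comm (length (doubles ps)) (length l) ⟩
  length l + length (doubles ps) ≡⟨ cong (length l +_) (length-doubles ps) ⟩
  length l + 2 * length ps       ∎
  where open ≡-Reasoning

record PairDecomposition {m} (x : List (Fin m)) : Set where
  field
    pairs core : List (Fin m)
    core-distinct : ∣ oddsupp core ∣ ≡ length core
    ↭-doubles++core : x ↭ doubles pairs ++ core

pairDecomposition : ∀ {m} (x : List (Fin m)) → PairDecomposition x
pairDecomposition {m} [] = record { pairs = [] ; core = [] ; core-distinct = ∣oddsupp-[]∣ {m} ; ↭-doubles++core = Perm.refl }
pairDecomposition (a ∷ x) with pairDecomposition x
... | record { pairs = ps ; core = core ; core-distinct = distinct ; ↭-doubles++core = x↭ }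
    with lookup (oddsupp core) a in a∈core?
... | false = record
  { pairs = ps
  ; core = a ∷ core
  ; core-distinct = trans (cong ∣_∣ (oddsupp-∷ a core)) (trans (∣toggle∣-outside a _ a∈core?) (cong suc distinct))
  ; ↭-doubles++core = ↭-trans (prep a x↭) (↭-sym (shift a (doubles ps) core))
  }
... | true with ∈-∃++ (∈-oddsupp⇒∈ a core a∈core?)
... | ys , zs , refl = record
  { pairs = a ∷ ps
  ; core = ys ++ zs
  ; core-distinct = suc-injective (trans (∣oddsupp∣-remove ys a zs a∈core?) (trans distinct (length-++-∷ ys a zs)))
  ; ↭-doubles++core = ↭-trans (prep a x↭) (prep a (begin
      doubles ps ++ ys ++ a ∷ zs     ≡⟨ sym (++-assoc (doubles ps) ys (a ∷ zs)) ⟩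
      (doubles ps ++ ys) ++ a ∷ zs   ↭⟨ shift a (doubles ps ++ ys) zs ⟩
      a ∷ (doubles ps ++ ys) ++ zs   ≡⟨ cong (a ∷_) (++-assoc (doubles ps) ys zs) ⟩
      a ∷ doubles ps ++ ys ++ zs     ∎))
  }
  where open PermutationReasoning

oddsupp-map-suc : ∀ {m} (l : List (Fin m)) → oddsupp (map suc l) ≡ false ∷ oddsupp l
oddsupp-map-suc []      = refl
oddsupp-map-suc (a ∷ l) = begin
  oddsupp (suc a ∷ map suc l)          ≡⟨ oddsupp-∷ (suc a) (map suc l) ⟩
  toggle (suc a) (oddsupp (map suc l)) ≡⟨ cong (toggle (suc a)) (oddsupp-map-suc l) ⟩
  false ∷ toggle a (oddsupp l)         ≡⟨ cong (false ∷_) (sym (oddsupp-∷ a l)) ⟩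
  false ∷ oddsupp (a ∷ l)              ∎
  where open ≡-Reasoning

members : ∀ {m} → Subset m → List (Fin m)
members []          = []
members (true ∷ S)  = zero ∷ map suc (members S)
members (false ∷ S) = map suc (members S)

oddsupp-members : ∀ {m} (S : Subset m) → oddsupp (members S) ≡ S
oddsupp-members []          = refl
oddsupp-members (true ∷ S)  =
  trans (oddsupp-∷ zero (map suc (members S)))
        (cong (toggle zero) (trans (oddsupp-map-suc (members S)) (cong (false ∷_) (oddsupp-members S))))
oddsupp-members (false ∷ S) = trans (oddsupp-map-suc (members S)) (cong (false ∷_) (oddsupp-members S))

length-members : ∀ {m} (S : Subset m) → length (members S) ≡ ∣ S ∣
length-members []          = refl
length-members (true ∷ S)  = cong suc (trans (length-map suc (members S)) (length-members S))
length-members (false ∷ S) = trans (length-map suc (members S)) (length-members S)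

toList-onto : ∀ {A : Set} {n} (l : List A) → length l ≡ n → ∃ λ (x : Vec A n) → toList x ≡ l
toList-onto l refl = fromList l , toList∘fromList l

2∤1+2t : ∀ t → ¬ 2 ∣ suc (2 * t)
2∤1+2t t 2∣1+2t = contradiction (∣1⇒≡1 (∣m+n∣m⇒∣n (subst (2 ∣_) (+-comm 1 (2 * t)) 2∣1+2t) (m∣m*n t))) λ ()

oddsupp-onto : ∀ {m n t} → n ≡ m + suc (2 * t) → (S : Subset m) → InP' n S →
  ∃ λ (x : Vec (Fin m) n) → oddsupp (toList x) ≡ S
oddsupp-onto {zero} {t = t} refl [] (_ , 2∣n) = contradiction 2∣n (2∤1+2t t)
oddsupp-onto {suc m} {n} _ S (∣S∣≤n , divides q n∸∣S∣≡q*2) with toList-onto l length-l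
  where
  l : List (Fin (suc m))
  l = doubles (replicate q zero) ++ members S
  length-l : length l ≡ n
  length-l = begin
    length (doubles (replicate q zero) ++ members S)
      ≡⟨ length-++ (doubles (replicate q zero)) ⟩
    length (doubles (replicate q zero)) + length (members S)
      ≡⟨ cong₂ _+_ (length-doubles (replicate q zero)) (length-members S) ⟩
    2 * length (replicate q zero) + ∣ S ∣
      ≡⟨ cong (λ k → 2 * k + ∣ S ∣) (length-replicate q) ⟩
    2 * q + ∣ S ∣
      ≡⟨ cong (_+ ∣ S ∣) (trans (*-comm 2 q) (sym n∸∣S∣≡q*2)) ⟩
    n ∸ ∣ S ∣ + ∣ S ∣
      ≡⟨ m∸n+n≡m ∣S∣≤n ⟩
    n ∎
    where open ≡-Reasoning
... | x , x≡l =
  x , trans (cong oddsupp x≡l) (trans (oddsupp-doubles-++ (replicate q zero) (members S)) (oddsupp-members S))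

halfGap : ℕ → ℕ → Maybe ℕ
halfGap zero    zero          = just zero
halfGap zero    (suc zero)    = nothing
halfGap zero    (suc (suc D)) = mapᴹ suc (halfGap zero D)
halfGap (suc k) zero          = nothing
halfGap (suc k) (suc D)       = halfGap k D

halfGap-complete : ∀ k j → halfGap k (k + 2 * j) ≡ just j
halfGap-complete zero    zero    = refl
halfGap-complete zero    (suc j) rewrite *-suc 2 j = cong (mapᴹ suc) (halfGap-complete zero j)
halfGap-complete (suc k) j       = halfGap-complete k j

halfGap-sound : ∀ k D j → halfGap k D ≡ just j → k + 2 * j ≡ D
halfGap-sound zero    zero          .zero refl = refl
halfGap-sound zero    (suc (suc D)) j     eq with halfGap zero D in eq′
halfGap-sound zero    (suc (suc D)) .(suc j) refl | just j rewrite *-suc 2 j =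
  cong (λ d → suc (suc d)) (halfGap-sound zero D j eq′)
halfGap-sound (suc k) (suc D)       j     eq = cong suc (halfGap-sound k D j eq)

halfGap-∸ : ∀ D k j → 2 * j ≤ D → k ≡ D ∸ 2 * j → halfGap k D ≡ just j
halfGap-∸ D k j 2j≤D k≡ = trans (cong (halfGap k) (sym k+2j≡D)) (halfGap-complete k j)
  where
  k+2j≡D : k + 2 * j ≡ D
  k+2j≡D = trans (cong (_+ 2 * j) k≡) (m∸n+n≡m 2j≤D)

halfGap-self : ∀ D → halfGap D D ≡ just 0
halfGap-self zero    = refl
halfGap-self (suc D) = halfGap-self D

predᴹ : ℕ → Maybe ℕ
predᴹ zero    = nothing
predᴹ (suc j) = just j

halfGap-suc-suc : ∀ k D → halfGap (suc (suc k)) D ≡ (halfGap k D >>= predᴹ)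
halfGap-suc-suc zero    zero          = refl
halfGap-suc-suc zero    (suc zero)    = refl
halfGap-suc-suc zero    (suc (suc D)) with halfGap zero D
... | just j  = refl
... | nothing = refl
halfGap-suc-suc (suc k) zero          = refl
halfGap-suc-suc (suc k) (suc D)       = halfGap-suc-suc k D

binomialSeq : ℕ → ℕ → ℕ → Bool
binomialSeq s D k = maybe′ (λ j → isOdd ((s + j) C s)) false (halfGap k D)

evenDiff : (ℕ → Bool) → ℕ → Bool
evenDiff b k = b k xor b (suc (suc k))

isOdd-nCn : ∀ s → isOdd ((s + 0) C s) ≡ true
isOdd-nCn s rewrite +-identityʳ s | nCn≡1 s = refl

xor-cancelʳ : ∀ a b → (a xor b) xor b ≡ a
xor-cancelʳ true  true  = refl
xor-cancelʳ true  false = refl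
xor-cancelʳ false true  = refl
xor-cancelʳ false false = refl

evenDiff-binomialSeq : ∀ s D k → evenDiff (binomialSeq (suc s) D) k ≡ binomialSeq s D k
evenDiff-binomialSeq s D k rewrite halfGap-suc-suc k D with halfGap k D
... | nothing      = refl
... | just zero    rewrite isOdd-nCn (suc s) | isOdd-nCn s = refl
... | just (suc j) = trans (cong (_xor isOdd ((suc s + j) C suc s)) pascal) (xor-cancelʳ _ _)
  where
  pascal : isOdd ((suc s + suc j) C suc s) ≡ isOdd ((s + suc j) C s) xor isOdd ((suc s + j) C suc s)
  pascal = begin
    isOdd (suc (s + suc j) C suc s)                        ≡⟨ cong isOdd (sym (nCk+nC[k+1]≡[n+1]C[k+1] (s + suc j) s)) ⟩
    isOdd ((s + suc j) C s + (s + suc j) C suc s)          ≡⟨ isOdd-+ ((s + suc j) C s) _ ⟩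
    isOdd ((s + suc j) C s) xor isOdd ((s + suc j) C suc s)
      ≡⟨ cong (λ n → isOdd ((s + suc j) C s) xor isOdd (n C suc s)) (+-suc s j) ⟩
    isOdd ((s + suc j) C s) xor isOdd ((suc s + j) C suc s) ∎
    where open ≡-Reasoning

evenDiff-binomialSeq-zero-self : ∀ D → evenDiff (binomialSeq 0 D) D ≡ true
evenDiff-binomialSeq-zero-self D rewrite halfGap-suc-suc D D | halfGap-self D = refl

evenDiff-binomialSeq-zero-≢ : ∀ D k → ¬ k ≡ D → evenDiff (binomialSeq 0 D) k ≡ false
evenDiff-binomialSeq-zero-≢ D k k≢D rewrite halfGap-suc-suc k D with halfGap k D in eq
... | nothing      = refl
... | just (suc j) = refl
... | just zero    = contradiction (trans (sym (+-identityʳ k)) (halfGap-sound k D 0 eq)) k≢D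

2*≤⇒<1+/2 : ∀ D j → 2 * j ≤ D → j < suc (D / 2)
2*≤⇒<1+/2 D j 2j≤D = s≤s (begin
  j             ≡⟨ sym (m*n/n≡m j 2) ⟩
  j * 2 / 2     ≤⟨ /-monoˡ-≤ 2 (≤-trans (≤-reflexive (*-comm j 2)) 2j≤D) ⟩
  D / 2         ∎)
  where open ≤-Reasoning

<1+/2⇒2*≤ : ∀ D j → j < suc (D / 2) → 2 * j ≤ D
<1+/2⇒2*≤ D j (s≤s j≤D/2) = begin
  2 * j         ≡⟨ *-comm 2 j ⟩
  j * 2         ≤⟨ *-monoˡ-≤ 2 j≤D/2 ⟩
  D / 2 * 2     ≤⟨ m/n*n≤m D 2 ⟩
  D             ∎
  where open ≤-Reasoning

n/2∸t : ∀ D t → (suc D + suc (2 * t)) / 2 ∸ t ≡ suc (D / 2)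
n/2∸t D t = begin
  (suc D + suc (2 * t)) / 2 ∸ t  ≡⟨ cong (λ n → n / 2 ∸ t) (reassoc D t) ⟩
  (D + suc t * 2) / 2 ∸ t        ≡⟨ cong (_∸ t) (+-distrib-/-∣ʳ D (divides (suc t) refl)) ⟩
  (D / 2 + suc t * 2 / 2) ∸ t    ≡⟨ cong (λ q → D / 2 + q ∸ t) (m*n/n≡m (suc t) 2) ⟩
  D / 2 + suc t ∸ t              ≡⟨ cong (_∸ t) (+-suc (D / 2) t) ⟩
  suc (D / 2) + t ∸ t            ≡⟨ m+n∸n≡m (suc (D / 2)) t ⟩
  suc (D / 2)                    ∎
  where
  open ≡-Reasoning
  reassoc : ∀ D t → suc D + suc (2 * t) ≡ D + suc t * 2
  reassoc = solve-∀

n∸2[1+t+j] : ∀ D t j → (suc D + suc (2 * t)) ∸ 2 * (suc t + j) ≡ D ∸ 2 * j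
n∸2[1+t+j] D t j = begin
  (suc D + suc (2 * t)) ∸ 2 * (suc t + j)   ≡⟨ cong₂ _∸_ (reassoc D t) (*-distribˡ-+ 2 (suc t) j) ⟩
  (2 * suc t + D) ∸ (2 * suc t + 2 * j)     ≡⟨ [m+n]∸[m+o]≡n∸o (2 * suc t) D (2 * j) ⟩
  D ∸ 2 * j                                 ∎
  where
  open ≡-Reasoning
  reassoc : ∀ D t → suc D + suc (2 * t) ≡ 2 * suc t + D
  reassoc = solve-∀

excess-pairs : ∀ D t l Q → l + 2 * Q ≡ suc D + suc (2 * t) → l ≤ suc D →
  ∃ λ R → Q ≡ suc t + R × D ≡ l + 2 * R
excess-pairs D t l Q l+2Q≡n l≤1+D = R , sym 1+t+R≡Q , +-cancelʳ-≡ (2 * suc t) D (l + 2 * R) (begin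
  D + 2 * suc t           ≡⟨ reassoc D t ⟩
  suc D + suc (2 * t)     ≡⟨ sym l+2Q≡n ⟩
  l + 2 * Q               ≡⟨ cong (λ q → l + 2 * q) (sym 1+t+R≡Q) ⟩
  l + 2 * (suc t + R)     ≡⟨ reassoc′ l t R ⟩
  l + 2 * R + 2 * suc t   ∎)
  where
  open ≡-Reasoning
  reassoc : ∀ D t → D + 2 * suc t ≡ suc D + suc (2 * t)
  reassoc = solve-∀
  reassoc′ : ∀ l t R → l + 2 * (suc t + R) ≡ l + 2 * R + 2 * suc t
  reassoc′ = solve-∀
  1+t≤Q : suc t ≤ Q
  1+t≤Q = *-cancelˡ-< 2 t Q (+-cancelˡ-≤ (suc D) (suc (2 * t)) (2 * Q)
    (≤-trans (≤-reflexive (sym l+2Q≡n)) (+-monoˡ-≤ (2 * Q) l≤1+D)))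
  R : ℕ
  R = Q ∸ suc t
  1+t+R≡Q : suc t + R ≡ Q
  1+t+R≡Q = m+[n∸m]≡n 1+t≤Q

+-2*-suc : ∀ D R → D + 2 * suc R ≡ suc (suc (D + 2 * R))
+-2*-suc D R = trans (cong (D +_) (*-suc 2 R)) (trans (+-suc D _) (cong suc (+-suc D _)))

module Sums {c ℓ : Level} (B : AbelianGroup c ℓ) where
  open AbelianGroup B renaming (refl to ≈-refl; sym to ≈-sym; trans to ≈-trans)
  open BG B using (_·_; ∑)
  open CommutativeSemigroupProperties commutativeSemigroup using (interchange)

  ∑-cong : ∀ {A : Set} (L : List A) {F G : A → Carrier} → (∀ a → F a ≈ G a) → ∑ (map F L) ≈ ∑ (map G L)
  ∑-cong []      F≈G = ≈-refl
  ∑-cong (a ∷ L) F≈G = ∙-cong (F≈G a) (∑-cong L F≈G)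

  ∑-ε : ∀ {A : Set} (L : List A) → ∑ (map (λ _ → ε) L) ≈ ε
  ∑-ε []      = ≈-refl
  ∑-ε (a ∷ L) = ≈-trans (∙-congˡ (∑-ε L)) (identityʳ ε)

  ∑-∙ : ∀ {A : Set} (L : List A) (F G : A → Carrier) → ∑ (map (λ a → F a ∙ G a) L) ≈ ∑ (map F L) ∙ ∑ (map G L)
  ∑-∙ []      F G = ≈-sym (identityʳ ε)
  ∑-∙ (a ∷ L) F G = ≈-trans (∙-congˡ (∑-∙ L F G)) (interchange _ _ _ _)

  ∑-swap : ∀ {A A′ : Set} (L : List A) (L′ : List A′) (K : A → A′ → Carrier) →
    ∑ (map (λ a → ∑ (map (K a) L′)) L) ≈ ∑ (map (λ a′ → ∑ (map (λ a → K a a′) L)) L′)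
  ∑-swap []      L′ K = ≈-sym (∑-ε L′)
  ∑-swap (a ∷ L) L′ K = ≈-trans (∙-congˡ (∑-swap L L′ K)) (≈-sym (∑-∙ L′ (K a) _))

  ∑-filter : ∀ {A : Set} {p} {P : A → Set p} (P? : Decidable P) (L : List A) (F : A → Carrier) →
    ∑ (map F (filter P? L)) ≈ ∑ (map (λ a → if does (P? a) then F a else ε) L)
  ∑-filter P? []      F = ≈-refl
  ∑-filter P? (a ∷ L) F with does (P? a)
  ... | true  = ∙-congˡ (∑-filter P? L F)
  ... | false = ≈-trans (∑-filter P? L F) (≈-sym (identityˡ _))

  ∑-concatMap-pair : ∀ {A A′ : Set} (L : List A) (u v : A → A′) (F : A′ → Carrier) →
    ∑ (map F (concatMap (λ a → u a ∷ v a ∷ []) L)) ≈ ∑ (map (λ a → F (u a) ∙ F (v a)) L)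
  ∑-concatMap-pair []      u v F = ≈-refl
  ∑-concatMap-pair (a ∷ L) u v F = ≈-trans (∙-congˡ (∙-congˡ (∑-concatMap-pair L u v F))) (≈-sym (assoc _ _ _))

  ∑-applyUpTo-ε : ∀ L (F : ℕ → Carrier) → (∀ j → j < L → F j ≈ ε) → ∑ (applyUpTo F L) ≈ ε
  ∑-applyUpTo-ε zero    F F≈ε = ≈-refl
  ∑-applyUpTo-ε (suc L) F F≈ε =
    ≈-trans (∙-cong (F≈ε zero (s≤s z≤n)) (∑-applyUpTo-ε L (λ j → F (suc j)) (λ j j<L → F≈ε (suc j) (s≤s j<L))))
          (identityʳ ε)

  ∑-applyUpTo-single : ∀ L (F : ℕ → Carrier) j₀ → j₀ < L → (∀ j → j < L → ¬ j ≡ j₀ → F j ≈ ε) →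
    ∑ (applyUpTo F L) ≈ F j₀
  ∑-applyUpTo-single (suc L) F zero j₀<L F≈ε =
    ≈-trans (∙-congˡ (∑-applyUpTo-ε L (λ j → F (suc j)) (λ j j<L → F≈ε (suc j) (s≤s j<L) λ ())))
          (identityʳ _)
  ∑-applyUpTo-single (suc L) F (suc j₀) (s≤s j₀<L) F≈ε =
    ≈-trans (∙-cong (F≈ε zero (s≤s z≤n) λ ())
                  (∑-applyUpTo-single L (λ j → F (suc j)) j₀ j₀<L
                     λ j j<L j≢j₀ → F≈ε (suc j) (s≤s j<L) (λ eq → j≢j₀ (suc-injective eq))))
          (identityˡ _)

  ∑-halfGap : ∀ D k (b : ℕ → ℕ) x →
    ∑ (map (λ j → if does (k ℕ.≟ D ∸ 2 * j) then b j · x else ε) (upTo (suc (D / 2))))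
      ≈ maybe′ (λ j → b j · x) ε (halfGap k D)
  ∑-halfGap D k b x = ≈-trans (reflexive (cong ∑ (map-upTo F (suc (D / 2))))) (sum-by (halfGap k D) refl)
    where
    F : ℕ → Carrier
    F j = if does (k ℕ.≟ D ∸ 2 * j) then b j · x else ε
    F-ε : ∀ j → ¬ k ≡ D ∸ 2 * j → F j ≈ ε
    F-ε j k≢ = reflexive (cong (λ bit → if bit then b j · x else ε) (dec-false (k ℕ.≟ D ∸ 2 * j) k≢))
    F-≡ : ∀ j → k ≡ D ∸ 2 * j → F j ≈ b j · x
    F-≡ j k≡ = reflexive (cong (λ bit → if bit then b j · x else ε) (dec-true (k ℕ.≟ D ∸ 2 * j) k≡))
    matches : ∀ j → j < suc (D / 2) → k ≡ D ∸ 2 * j → halfGap k D ≡ just j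
    matches j j<L = halfGap-∸ D k j (<1+/2⇒2*≤ D j j<L)
    sum-by : ∀ g → halfGap k D ≡ g → ∑ (applyUpTo F (suc (D / 2))) ≈ maybe′ (λ j → b j · x) ε g
    sum-by nothing   eq = ∑-applyUpTo-ε _ F λ j j<L → F-ε j λ k≡ → just≢nothing (trans (sym (matches j j<L k≡)) eq)
      where just≢nothing : ∀ {j} → ¬ just j ≡ nothing
            just≢nothing ()
    sum-by (just j₀) eq =
      ≈-trans (∑-applyUpTo-single _ F j₀ (2*≤⇒<1+/2 D j₀ 2j₀≤D)
               λ j j<L j≢j₀ → F-ε j λ k≡ → j≢j₀ (just-injective (trans (sym (matches j j<L k≡)) eq)))
            (F-≡ j₀ (trans (sym (m+n∸n≡m k (2 * j₀))) (cong (_∸ 2 * j₀) k+2j₀≡D)))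
      where
      k+2j₀≡D : k + 2 * j₀ ≡ D
      k+2j₀≡D = halfGap-sound k D j₀ eq
      2j₀≤D : 2 * j₀ ≤ D
      2j₀≤D = ≤-trans (m≤n+m (2 * j₀) k) (≤-reflexive k+2j₀≡D)

module BooleanWeights {c ℓ : Level} (B : AbelianGroup c ℓ) (isBoolean : BG.IsBoolean B) {m : ℕ} where
  open AbelianGroup B renaming (refl to ≈-refl; sym to ≈-sym; trans to ≈-trans)
  open BG B using (_·_; ∑; rhs)
  open Sums B
  open CommutativeSemigroupProperties commutativeSemigroup using (interchange)
  open import Relation.Binary.Reasoning.Setoid setoid

  Weight : Set c
  Weight = ℕ → Subset m → Carrier

  infix 4 _≐_
  _≐_ : Weight → Weight → Set ℓ
  g ≐ h = ∀ k T → g k T ≈ h k T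

  ≐-refl : ∀ {h} → h ≐ h
  ≐-refl k T = ≈-refl

  ≐-trans : ∀ {g h i} → g ≐ h → h ≐ i → g ≐ i
  ≐-trans g≐h h≐i k T = ≈-trans (g≐h k T) (h≐i k T)

  Δ : Fin m → Weight → Weight
  Δ a h k T = h k T ∙ h (suc k) (toggle a T)

  Δ² : Weight → Weight
  Δ² h k T = h k T ∙ h (suc (suc k)) T

  Δ²^ : ℕ → Weight → Weight
  Δ²^ zero    h = h
  Δ²^ (suc R) h = Δ²^ R (Δ² h)

  Δ* : List (Fin m) → Weight → Weight
  Δ* []      h = h
  Δ* (a ∷ x) h = Δ* x (Δ a h)

  Δ-cong : ∀ a {g h} → g ≐ h → Δ a g ≐ Δ a h
  Δ-cong a g≐h k T = ∙-cong (g≐h k T) (g≐h (suc k) (toggle a T))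

  Δ²-cong : ∀ {g h} → g ≐ h → Δ² g ≐ Δ² h
  Δ²-cong g≐h k T = ∙-cong (g≐h k T) (g≐h (suc (suc k)) T)

  Δ²^-cong : ∀ R {g h} → g ≐ h → Δ²^ R g ≐ Δ²^ R h
  Δ²^-cong zero    g≐h = g≐h
  Δ²^-cong (suc R) g≐h = Δ²^-cong R (Δ²-cong g≐h)

  Δ*-cong : ∀ x {g h} → g ≐ h → Δ* x g ≐ Δ* x h
  Δ*-cong []      g≐h = g≐h
  Δ*-cong (a ∷ x) g≐h = Δ*-cong x (Δ-cong a g≐h)

  Δ-comm : ∀ a b h → Δ a (Δ b h) ≐ Δ b (Δ a h)
  Δ-comm a b h k T = begin
    (h k T ∙ h (suc k) (toggle b T)) ∙ (h (suc k) (toggle a T) ∙ h (suc (suc k)) (toggle b (toggle a T)))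
      ≈⟨ interchange _ _ _ _ ⟩
    (h k T ∙ h (suc k) (toggle a T)) ∙ (h (suc k) (toggle b T) ∙ h (suc (suc k)) (toggle b (toggle a T)))
      ≡⟨ cong (λ S → (h k T ∙ h (suc k) (toggle a T)) ∙ (h (suc k) (toggle b T) ∙ h (suc (suc k)) S))
                (toggle-comm b a T) ⟩
    (h k T ∙ h (suc k) (toggle a T)) ∙ (h (suc k) (toggle b T) ∙ h (suc (suc k)) (toggle a (toggle b T))) ∎

  ∙-cancel-middle : ∀ x y z → (x ∙ y) ∙ (y ∙ z) ≈ x ∙ z
  ∙-cancel-middle x y z = begin
    (x ∙ y) ∙ (y ∙ z) ≈⟨ assoc x y (y ∙ z) ⟩
    x ∙ (y ∙ (y ∙ z)) ≈⟨ ∙-congˡ (≈-sym (assoc y y z)) ⟩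
    x ∙ ((y ∙ y) ∙ z) ≈⟨ ∙-congˡ (∙-congʳ (isBoolean y)) ⟩
    x ∙ (ε ∙ z)       ≈⟨ ∙-congˡ (identityˡ z) ⟩
    x ∙ z             ∎

  Δ-Δ≐Δ² : ∀ a h → Δ a (Δ a h) ≐ Δ² h
  Δ-Δ≐Δ² a h k T = begin
    (h k T ∙ h (suc k) (toggle a T)) ∙ (h (suc k) (toggle a T) ∙ h (suc (suc k)) (toggle a (toggle a T)))
      ≈⟨ ∙-cancel-middle _ _ _ ⟩
    h k T ∙ h (suc (suc k)) (toggle a (toggle a T))
      ≡⟨ cong (λ S → h k T ∙ h (suc (suc k)) S) (toggle-involutive a T) ⟩
    h k T ∙ h (suc (suc k)) T ∎

  Δ*-++ : ∀ xs ys h → Δ* (xs ++ ys) h ≡ Δ* ys (Δ* xs h)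
  Δ*-++ []       ys h = refl
  Δ*-++ (a ∷ xs) ys h = Δ*-++ xs ys (Δ a h)

  Δ*-↭ : ∀ {xs ys} → xs ↭ ys → ∀ h → Δ* xs h ≐ Δ* ys h
  Δ*-↭ Perm.refl               h = ≐-refl
  Δ*-↭ (Perm.prep a p)         h = Δ*-↭ p (Δ a h)
  Δ*-↭ (Perm.swap {xs} a b p)  h = ≐-trans (Δ*-cong xs (Δ-comm b a h)) (Δ*-↭ p (Δ a (Δ b h)))
  Δ*-↭ (Perm.trans p q)        h = ≐-trans (Δ*-↭ p h) (Δ*-↭ q h)

  Δ*-doubles : ∀ ps h → Δ* (doubles ps) h ≐ Δ²^ (length ps) h
  Δ*-doubles []       h = ≐-refl
  Δ*-doubles (a ∷ ps) h = ≐-trans (Δ*-cong (doubles ps) (Δ-Δ≐Δ² a h)) (Δ*-doubles ps (Δ² h))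

  Δ²^-+ : ∀ a b h → Δ²^ (a + b) h ≡ Δ²^ b (Δ²^ a h)
  Δ²^-+ zero    b h = refl
  Δ²^-+ (suc a) b h = Δ²^-+ a b (Δ² h)

  Vanishes : ℕ → Weight → Set ℓ
  Vanishes D g = ∀ k T → k < D → g k T ≈ ε

  Δ*-vanishing : ∀ y g → Vanishes (length y) g → Δ* y g 0 (oddsupp []) ≈ g (length y) (oddsupp y)
  Δ*-vanishing []      g g≈ε = ≈-refl
  Δ*-vanishing (a ∷ y) g g≈ε = begin
    Δ* y (Δ a g) 0 (oddsupp [])
      ≈⟨ Δ*-vanishing y (Δ a g) Δag≈ε ⟩
    g (length y) (oddsupp y) ∙ g (suc (length y)) (toggle a (oddsupp y))
      ≈⟨ ∙-congʳ (g≈ε _ _ (n<1+n _)) ⟩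
    ε ∙ g (suc (length y)) (toggle a (oddsupp y))
      ≈⟨ identityˡ _ ⟩
    g (suc (length y)) (toggle a (oddsupp y))
      ≡⟨ cong (g (suc (length y))) (sym (oddsupp-∷ a y)) ⟩
    g (suc (length y)) (oddsupp (a ∷ y)) ∎
    where
    Δag≈ε : Vanishes (length y) (Δ a g)
    Δag≈ε k T k<y = ≈-trans (∙-cong (g≈ε k T (m<n⇒m<1+n k<y)) (g≈ε (suc k) _ (s≤s k<y))) (identityʳ ε)

  Peaks : ℕ → (Subset m → Carrier) → Weight → Set ℓ
  Peaks D ψ g = Vanishes D g × (∀ T → g D T ≈ ψ T)

  Δ²^-peaks : ∀ R D ψ g → Peaks (D + 2 * R) ψ g → Peaks D ψ (Δ²^ R g)
  Δ²^-peaks zero    D ψ g (g≈ε , g≈ψ) rewrite +-identityʳ D = g≈ε , g≈ψ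
  Δ²^-peaks (suc R) D ψ g (g≈ε , g≈ψ) rewrite +-2*-suc D R = Δ²^-peaks R D ψ (Δ² g) (Δ²g≈ε , Δ²g≈ψ)
    where
    Δ²g≈ε : Vanishes (D + 2 * R) (Δ² g)
    Δ²g≈ε k T k< = ≈-trans (∙-cong (g≈ε k T (m<n⇒m<1+n (m<n⇒m<1+n k<))) (g≈ε _ T (s≤s (s≤s k<)))) (identityʳ ε)
    Δ²g≈ψ : ∀ T → Δ² g (D + 2 * R) T ≈ ψ T
    Δ²g≈ψ T = ≈-trans (∙-congʳ (g≈ε _ T (m<n⇒m<1+n (n<1+n _)))) (≈-trans (identityˡ _) (g≈ψ T))

  onSizes : (ℕ → Bool) → (Subset m → Carrier) → Weight
  onSizes b φ k T = if b k then φ T else ε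

  onSizes-cong : ∀ {b b′} φ → (∀ k → b k ≡ b′ k) → onSizes b φ ≐ onSizes b′ φ
  onSizes-cong φ b≡b′ k T = reflexive (cong (λ bit → if bit then φ T else ε) (b≡b′ k))

  Δ²-onSizes : ∀ b φ → Δ² (onSizes b φ) ≐ onSizes (evenDiff b) φ
  Δ²-onSizes b φ k T with b k | b (suc (suc k))
  ... | true  | true  = isBoolean (φ T)
  ... | true  | false = identityʳ _
  ... | false | true  = identityˡ _
  ... | false | false = identityʳ _

  Δ²^-binomialSeq : ∀ s D φ → Δ²^ (suc s) (onSizes (binomialSeq s D) φ) ≐ onSizes (evenDiff (binomialSeq 0 D)) φ
  Δ²^-binomialSeq zero    D φ = Δ²-onSizes (binomialSeq 0 D) φ
  Δ²^-binomialSeq (suc s) D φ =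
    ≐-trans (Δ²^-cong (suc s) (≐-trans (Δ²-onSizes (binomialSeq (suc s) D) φ)
                                       (onSizes-cong φ (evenDiff-binomialSeq s D))))
            (Δ²^-binomialSeq s D φ)

  onSizes-evenDiff-binomialSeq-peaks : ∀ D φ → Peaks D φ (onSizes (evenDiff (binomialSeq 0 D)) φ)
  onSizes-evenDiff-binomialSeq-peaks D φ =
    (λ k T k<D → reflexive (cong (λ bit → if bit then φ T else ε)
                                    (evenDiff-binomialSeq-zero-≢ D k (λ k≡D → <-irrefl k≡D k<D)))) ,
    (λ T → reflexive (cong (λ bit → if bit then φ T else ε) (evenDiff-binomialSeq-zero-self D)))

  ·-isOdd : ∀ k x → k · x ≈ (if isOdd k then x else ε)
  ·-isOdd zero    x = ≈-refl
  ·-isOdd (suc k) x rewrite isOdd-suc k with isOdd k | ·-isOdd k x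
  ... | true  | k·x≈x = ≈-trans (∙-congˡ k·x≈x) (isBoolean x)
  ... | false | k·x≈ε = ≈-trans (∙-congˡ k·x≈ε) (identityʳ x)

  subsetSum : ∀ {n} → Vec (Fin m) n → Weight → Carrier
  subsetSum {n} x h = ∑ (map (λ I → h ∣ I ∣ (oddsupp (restrict x I))) (allSubsets n))

  subsetSum-∷ : ∀ {n} a (x : Vec (Fin m) n) h → subsetSum (a ∷ x) h ≈ subsetSum x (Δ a h)
  subsetSum-∷ {n} a x h = ≈-trans (∑-concatMap-pair (allSubsets n) (outside ∷_) (inside ∷_) _)
    (∑-cong (allSubsets n) λ I → ∙-congˡ (reflexive (cong (h (suc ∣ I ∣)) (oddsupp-∷ a (restrict x I)))))

  subsetSum≈Δ* : ∀ {n} (x : Vec (Fin m) n) h → subsetSum x h ≈ Δ* (toList x) h 0 (oddsupp [])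
  subsetSum≈Δ* []      h = identityʳ _
  subsetSum≈Δ* (a ∷ x) h = ≈-trans (subsetSum-∷ a x h) (subsetSum≈Δ* x (Δ a h))

  rhsWeight : ℕ → ℕ → (Subset m → Carrier) → Weight
  rhsWeight n t φ k T =
    ∑ (map (λ i → if does (k ℕ.≟ n ∸ 2 * i) then ((i ∸ 1) C t) · φ T else ε)
           (map (λ j → suc t + j) (upTo (n / 2 ∸ t))))

  rhs≈subsetSum : ∀ n t φ (x : Vec (Fin m) n) → rhs n t φ x ≈ subsetSum x (rhsWeight n t φ)
  rhs≈subsetSum n t φ x =
    ≈-trans (∑-cong (map (λ j → suc t + j) (upTo (n / 2 ∸ t)))
                  (λ i → ∑-filter (λ I → ∣ I ∣ ℕ.≟ n ∸ 2 * i) (allSubsets n) _))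
          (∑-swap (map (λ j → suc t + j) (upTo (n / 2 ∸ t))) (allSubsets n) _)

  -- With i = t + 1 + j, the coefficient C(i − 1, t) of the right-hand side sits at size D − 2j.
  rhsWeight≐onSizes : ∀ D t φ → rhsWeight (suc D + suc (2 * t)) t φ ≐ onSizes (binomialSeq t D) φ
  rhsWeight≐onSizes D t φ k T = begin
    rhsWeight n t φ k T
      ≡⟨ cong ∑ (sym (map-∘ (upTo (n / 2 ∸ t)))) ⟩
    ∑ (map (λ j → term (n ∸ 2 * (suc t + j)) j) (upTo (n / 2 ∸ t)))
      ≡⟨ cong (λ L → ∑ (map (λ j → term (n ∸ 2 * (suc t + j)) j) (upTo L))) (n/2∸t D t) ⟩
    ∑ (map (λ j → term (n ∸ 2 * (suc t + j)) j) (upTo (suc (D / 2))))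
      ≈⟨ ∑-cong (upTo (suc (D / 2))) (λ j → reflexive (cong (λ d → term d j) (n∸2[1+t+j] D t j))) ⟩
    ∑ (map (λ j → term (D ∸ 2 * j) j) (upTo (suc (D / 2))))
      ≈⟨ ∑-halfGap D k (λ j → (t + j) C t) (φ T) ⟩
    maybe′ (λ j → ((t + j) C t) · φ T) ε (halfGap k D)
      ≈⟨ by-parity (halfGap k D) ⟩
    onSizes (binomialSeq t D) φ k T ∎
    where
    n : ℕ
    n = suc D + suc (2 * t)
    term : ℕ → ℕ → Carrier
    term d j = if does (k ℕ.≟ d) then ((t + j) C t) · φ T else ε
    by-parity : ∀ g → maybe′ (λ j → ((t + j) C t) · φ T) ε g
                        ≈ (if maybe′ (λ j → isOdd ((t + j) C t)) false g then φ T else ε)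
    by-parity nothing  = ≈-refl
    by-parity (just j) = ·-isOdd ((t + j) C t) (φ T)

module _ {c ℓ : Level} (B : AbelianGroup c ℓ) (isBoolean : BG.IsBoolean B) where
  open AbelianGroup B renaming (refl to ≈-refl; sym to ≈-sym; trans to ≈-trans)
  open BG B using (rhs)

  rhs≈φ∘oddsupp : ∀ {m n t} → n ≡ m + suc (2 * t) →
    ∀ φ (x : Vec (Fin m) n) → rhs n t φ x ≈ φ (oddsupp (toList x))
  rhs≈φ∘oddsupp {zero}            refl φ (() ∷ _)
  rhs≈φ∘oddsupp {suc D} {t = t}   refl φ x = begin
    rhs n t φ x                               ≈⟨ rhs≈subsetSum n t φ x ⟩
    subsetSum x w                             ≈⟨ subsetSum≈Δ* x w ⟩
    Δ* xs w 0 ∅                               ≈⟨ Δ*-↭ ↭-doubles++core w 0 ∅ ⟩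
    Δ* (doubles pairs ++ core) w 0 ∅          ≡⟨ cong (λ h → h 0 ∅) (Δ*-++ (doubles pairs) core w) ⟩
    Δ* core (Δ* (doubles pairs) w) 0 ∅        ≈⟨ Δ*-cong core (Δ*-doubles pairs w) 0 ∅ ⟩
    Δ* core (Δ²^ (length pairs) w) 0 ∅        ≡⟨ cong (λ h → Δ* core h 0 ∅) Δ²^Q≡Δ²^R∘Δ²^[1+t] ⟩
    Δ* core (Δ²^ R (Δ²^ (suc t) w)) 0 ∅       ≈⟨ Δ*-cong core (Δ²^-cong R Δ²^[1+t]w≐δ) 0 ∅ ⟩
    Δ* core (Δ²^ R δ) 0 ∅                     ≈⟨ Δ*-vanishing core (Δ²^ R δ) (proj₁ peak) ⟩
    Δ²^ R δ (length core) (oddsupp core)      ≈⟨ proj₂ peak (oddsupp core) ⟩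
    φ (oddsupp core)                          ≡⟨ cong φ (sym oddsupp-xs) ⟩
    φ (oddsupp xs)                            ∎
    where
    open BooleanWeights B isBoolean {suc D}
    open import Relation.Binary.Reasoning.Setoid setoid
    open PairDecomposition (pairDecomposition (toList x))
    n : ℕ
    n = suc D + suc (2 * t)
    xs : List (Fin (suc D))
    xs = toList x
    ∅ : Subset (suc D)
    ∅ = oddsupp []
    w δ : Weight
    w = rhsWeight n t φ
    δ = onSizes (evenDiff (binomialSeq 0 D)) φ
    Δ²^[1+t]w≐δ : Δ²^ (suc t) w ≐ δ
    Δ²^[1+t]w≐δ = ≐-trans (Δ²^-cong (suc t) (rhsWeight≐onSizes D t φ)) (Δ²^-binomialSeq t D φ)
    length-xs : length core + 2 * length pairs ≡ n
    length-xs = trans (sym (length-↭-doubles++ pairs core ↭-doubles++core)) (length-toList x)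
    pairs-split : ∃ λ R → length pairs ≡ suc t + R × D ≡ length core + 2 * R
    pairs-split = excess-pairs D t (length core) (length pairs) length-xs
                    (subst (_≤ suc D) core-distinct (∣p∣≤n (oddsupp core)))
    R : ℕ
    R = proj₁ pairs-split
    Δ²^Q≡Δ²^R∘Δ²^[1+t] : Δ²^ (length pairs) w ≡ Δ²^ R (Δ²^ (suc t) w)
    Δ²^Q≡Δ²^R∘Δ²^[1+t] = trans (cong (λ q → Δ²^ q w) (proj₁ (proj₂ pairs-split))) (Δ²^-+ (suc t) R w)
    peak : Peaks (length core) φ (Δ²^ R δ)
    peak = Δ²^-peaks R (length core) φ δ
             (subst (λ d → Peaks d φ δ) (proj₂ (proj₂ pairs-split)) (onSizes-evenDiff-binomialSeq-peaks D φ))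
    oddsupp-xs : oddsupp xs ≡ oddsupp core
    oddsupp-xs = trans (oddsupp-↭ ↭-doubles++core) (oddsupp-doubles-++ pairs core)

theorem4p1 : {c ℓ : Level} (B : AbelianGroup c ℓ) → BG.IsBoolean B → BG.IsFinite B →
    (m n t : ℕ) → n ≡ m + suc (2 * t) →
    (f : Vec (Fin m) n → AbelianGroup.Carrier B) →
    ((BG.DeterminedByOddsupp B f → Σ (Subset m → AbelianGroup.Carrier B) λ φ → BG.Represents B t φ f)
      × ((Σ (Subset m → AbelianGroup.Carrier B) λ φ → BG.Represents B t φ f) → BG.DeterminedByOddsupp B f))
    × ((φ φ' : Subset m → AbelianGroup.Carrier B) → BG.Represents B t φ f → BG.Represents B t φ' f →
        (S : Subset m) → InP' n S → AbelianGroup._≈_ B (φ S) (φ' S))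
theorem4p1 B isBoolean _ m n t n≡ f =
  ( (λ (ψ , f≈ψ) → ψ , λ x → ≈-trans (f≈ψ x) (≈-sym (rhs≈ ψ x)))
  , (λ (φ , f≈rhs) → φ , λ x → ≈-trans (f≈rhs x) (rhs≈ φ x)) )
  , λ φ φ′ f≈rhsφ f≈rhsφ′ S S∈P′ → let (x , x↦S) = oddsupp-onto {m} {n} {t} n≡ S S∈P′ in begin
      φ S                        ≡⟨ cong φ (sym x↦S) ⟩
      φ (oddsupp (toList x))     ≈⟨ rhs≈ φ x ⟨
      BG.rhs B n t φ x           ≈⟨ f≈rhsφ x ⟨
      f x                        ≈⟨ f≈rhsφ′ x ⟩
      BG.rhs B n t φ′ x          ≈⟨ rhs≈ φ′ x ⟩
      φ′ (oddsupp (toList x))    ≡⟨ cong φ′ x↦S ⟩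
      φ′ S                       ∎
  where
  open AbelianGroup B renaming (refl to ≈-refl; sym to ≈-sym; trans to ≈-trans)
  open import Relation.Binary.Reasoning.Setoid setoid
  rhs≈ : ∀ φ (x : Vec (Fin m) n) → BG.rhs B n t φ x ≈ φ (oddsupp (toList x))
  rhs≈ = rhs≈φ∘oddsupp B isBoolean {m} {n} {t} n≡
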